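{- Let $m\ge1$, let $a\in\{0,1\}^{m+1}$ be a keyword, and let $n,n'\ge 1$. For any $u,v\in\{0,1\}^n$ and $w\in\{0,1\}^{n'}$ the following hold: (1) $u\sim_a v$ if and only if $u\oplus w\sim_a v\oplus w$; (2) $u\sim_a v$ if and only if $w\oplus u\sim_a w\oplus v$. (Here $\sim_a$ on the left is the relation on $\{0,1\}^n$, and on the right the relation on $\{0,1\}^{n+n'}$.)
   Context: A binary word of length $n$ is an element of $\{0,1\}^n$; the negation $\neg u$ flips every letter. For $u\in\{0,1\}^n$, $u_{[i,j]}=(u_i,\dots,u_j)$. The concatenation of $u\in\{0,1\}^n$ and $w\in\{0,1\}^{n'}$ is $u\oplus w=(u_1,\dots,u_n,w_1,\dots,w_{n'})\in\{0,1\}^{n+n'}$. For a keyword $a\in\{0,1\}^{m+1}$ and an index $i\in\{1,\dots,N\}$, the simple map $\varphi_i^{(a)}:\{0,1\}^N\to\{0,1\}^N$ negates the letters in positions $i,\dots,i+m$ of $u$ if $i+m\le N$ and $u_{[i,i+m]}\in\{a,\neg a\}$, and otherwise leaves $u$ unchanged. On $\{0,1\}^N$, $u\sim_a v$ means there exist indices $i_1,\dots,i_r$ ($r\ge0$) with $(\varphi_{i_r}^{(a)}\circ\cdots\circ\varphi_{i_1}^{(a)})(u)=v$. -}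

module Defs where

open import Data.Bool using (Bool; not; if_then_else_)
open import Data.Nat using (ℕ; zero; suc; _+_; _∸_; _≤_; _<_; _≤?_; _<?_)
open import Data.Fin using (Fin; toℕ; fromℕ<)
open import Data.Vec using (Vec; lookup; tabulate; map; _++_)
open import Data.List using (List; []; _∷_; foldr)
open import Data.Product using (∃; _×_)
open import Data.List.Relation.Unary.All using (All)
open import Relation.Nullary using (Dec; yes; no; _×-dec_; _⊎-dec_)
open import Relation.Nullary.Decidable using (⌊_⌋)
open import Relation.Binary.PropositionalEquality using (_≡_)
open import Data.Vec.Properties using (≡-dec)
open import Data.Bool.Properties using () renaming (_≟_ to _≟B_)

-- Binary words of length n: elements of {0,1}^n, letters as Bool
-- (false = 0, true = 1). Positions are 1-based in the paper; position p
-- corresponds to the Fin index p - 1.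
Word : ℕ → Set
Word n = Vec Bool n

neg : ∀ {n} → Word n → Word n
neg = map not

-- Concatenation u ⊕ w is Data.Vec._++_ .

-- The subword u_[i,i+m] (1-based, so 0-based positions i-1 .. i-1+m),
-- available when 1 ≤ i and i + m ≤ N.
window : ∀ {N} (m : ℕ) (u : Word N) (i : ℕ) → 1 ≤ i → i + m ≤ N → Word (suc m)
window {N} m u (suc i') _ le =
  tabulate λ j → lookup u (fromℕ< {i' + toℕ j} (lemma j))
  where
    open import Data.Nat using (s≤s)
    open import Data.Nat.Properties using (+-monoʳ-≤; ≤-trans)
    open import Data.Fin.Properties using (toℕ≤pred[n])
    lemma : (j : Fin (suc m)) → i' + toℕ j < N
    lemma j = ≤-trans (s≤s (+-monoʳ-≤ i' (toℕ≤pred[n] j))) le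

flipRange : ∀ {N} (m i : ℕ) → Word N → Word N
flipRange m i u = tabulate λ k →
  if ⌊ (i ≤? suc (toℕ k)) ×-dec (suc (toℕ k) ≤? i + m) ⌋
  then not (lookup u k) else lookup u k

φ : ∀ {N} {m : ℕ} (a : Word (suc m)) (i : ℕ) → Word N → Word N
φ {N} {m} a i u with 1 ≤? i | i + m ≤? N
... | yes p | yes q with ≡-dec _≟B_ (window m u i p q) a
                       ⊎-dec ≡-dec _≟B_ (window m u i p q) (neg a)
...   | yes _ = flipRange m i u
...   | no  _ = u
φ a i u | _ | _ = u

applySeq : ∀ {N} {m : ℕ} (a : Word (suc m)) → List ℕ → Word N → Word N
applySeq a []       u = u
applySeq a (i ∷ is) u = applySeq a is (φ a i u)

_∼[_]_ : ∀ {N} {m : ℕ} → Word N → Word (suc m) → Word N → Set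
_∼[_]_ {N} u a v =
  ∃ λ (is : List ℕ) → All (λ i → 1 ≤ i × i ≤ N) is × applySeq a is u ≡ v

{-# OPTIONS --safe #-}

-- On the underlying lists, φᵢ^(a) rewrites p W q to p (¬W) q for W ∈ {a, ¬a}; such rewriting is
-- stable under concatenation, so only cancellation needs an argument. To cancel a first letter
-- c from c x ∼ c y, follow the derivation: flips of the first letter come in pairs, with windows
-- c W and ¬c W′ in {a, ¬a}, hence W′ = ¬W. In between, ¬W z ∼ ¬W z′ without touching the first
-- letter, so z ∼ z′ by induction on the length, and the pair can be replaced by W z ∼ W z′.
-- Cancellation on the right follows by reversing the words and the keyword.

module Submission where

open import Defs
open import Data.Bool using (Bool; not; if_then_else_; _∧_)
open import Data.Bool.Properties using (not-involutive; not-¬)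
open import Data.Empty using (⊥-elim)
open import Data.Nat using (ℕ; zero; suc; _+_; _≤_; _<_; _≤ᵇ_; z≤n; s≤s; s≤s⁻¹)
open import Data.Nat.Properties using (≤-refl; ≤-reflexive; ≤-trans; <⇒≤; <-≤-trans)
open import Data.Product using (∃; ∃₂; _×_; _,_; proj₁; proj₂)
open import Data.Sum using (_⊎_; inj₁; inj₂)
open import Relation.Binary.PropositionalEquality
  using (_≡_; refl; sym; trans; cong; cong₂; subst; subst₂; module ≡-Reasoning)
open import Relation.Binary.Construct.Closure.ReflexiveTransitive using (Star; ε; _◅_; _◅◅_; gmap)

module ListRewriting where

  open import Data.List using (List; []; _∷_; _++_; length; map; reverse)
  open import Data.List.Properties
    using ( ++-assoc; length-map; map-∘; map-cong; map-id; reverse-++; reverse-involutive; reverse-map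
          ; ∷-injectiveˡ; ∷-injectiveʳ)

  private variable
    A W V x y : List Bool
    b c : Bool
    n : ℕ

  negL : List Bool → List Bool
  negL = map not

  negL-involutive : ∀ W → negL (negL W) ≡ W
  negL-involutive W = trans (sym (map-∘ W)) (trans (map-cong not-involutive W) (map-id W))

  length-negL-middle : ∀ p W q → length (p ++ negL W ++ q) ≡ length (p ++ W ++ q)
  length-negL-middle []      []      q = refl
  length-negL-middle []      (_ ∷ W) q = cong suc (length-negL-middle [] W q)
  length-negL-middle (_ ∷ p) W       q = cong suc (length-negL-middle p W q)

  infix 4 _∈±_
  _∈±_ : List Bool → List Bool → Set
  W ∈± A = W ≡ A ⊎ W ≡ negL A

  ∈±-euclidean : V ∈± A → W ∈± A → W ∈± V
  ∈±-euclidean (inj₁ refl) (inj₁ refl) = inj₁ refl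
  ∈±-euclidean (inj₁ refl) (inj₂ refl) = inj₂ refl
  ∈±-euclidean (inj₂ refl) (inj₁ refl) = inj₂ (sym (negL-involutive _))
  ∈±-euclidean (inj₂ refl) (inj₂ refl) = inj₁ refl

  ∈±-∷-not : (c ∷ W) ∈± A → (not c ∷ V) ∈± A → V ≡ negL W
  ∈±-∷-not e e′ with ∈±-euclidean e e′
  ... | inj₁ eq = ⊥-elim (not-¬ refl (sym (∷-injectiveˡ eq)))
  ... | inj₂ eq = ∷-injectiveʳ eq

  ∈±-reverse : W ∈± A → reverse W ∈± reverse A
  ∈±-reverse (inj₁ refl) = inj₁ refl
  ∈±-reverse {A = A} (inj₂ refl) = inj₂ (sym (reverse-map not A))

  ∈±-length : W ∈± A → length W ≡ length A
  ∈±-length (inj₁ refl) = refl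
  ∈±-length {A = A} (inj₂ refl) = length-map not A

  -- On toList, the simple map φᵢ^(a) is flipAt with |p| = i - 1.
  data FlipStep (A : List Bool) : List Bool → List Bool → Set where
    flipAt : ∀ p W q → W ∈± A → FlipStep A (p ++ W ++ q) (p ++ negL W ++ q)

  flipStep-length : FlipStep A x y → length y ≡ length x
  flipStep-length (flipAt p W q _) = length-negL-middle p W q

  infix 4 _≈[_]_
  _≈[_]_ : List Bool → List Bool → List Bool → Set
  x ≈[ A ] y = Star (FlipStep A) x y

  flipStep-++ˡ : ∀ w → FlipStep A x y → FlipStep A (w ++ x) (w ++ y)
  flipStep-++ˡ {A} w (flipAt p W q e) =
    subst₂ (FlipStep A) (++-assoc w p (W ++ q)) (++-assoc w p (negL W ++ q)) (flipAt (w ++ p) W q e)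

  ≈-++ˡ : ∀ w → x ≈[ A ] y → w ++ x ≈[ A ] w ++ y
  ≈-++ˡ w = gmap (w ++_) (flipStep-++ˡ w)

  reverse-++₃ : ∀ (p W q : List Bool) → reverse (p ++ W ++ q) ≡ reverse q ++ reverse W ++ reverse p
  reverse-++₃ p W q = begin
    reverse (p ++ W ++ q)                  ≡⟨ reverse-++ p (W ++ q) ⟩
    reverse (W ++ q) ++ reverse p          ≡⟨ cong (_++ reverse p) (reverse-++ W q) ⟩
    (reverse q ++ reverse W) ++ reverse p  ≡⟨ ++-assoc (reverse q) (reverse W) (reverse p) ⟩
    reverse q ++ reverse W ++ reverse p    ∎
    where open ≡-Reasoning

  flipStep-reverse : FlipStep A x y → FlipStep (reverse A) (reverse x) (reverse y)
  flipStep-reverse {A} (flipAt p W q e) =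
    subst₂ (FlipStep (reverse A)) (sym (reverse-++₃ p W q)) (sym reversed-target)
      (flipAt (reverse q) (reverse W) (reverse p) (∈±-reverse e))
    where
    reversed-target : reverse (p ++ negL W ++ q) ≡ reverse q ++ negL (reverse W) ++ reverse p
    reversed-target = trans (reverse-++₃ p (negL W) q)
                            (cong (λ V → reverse q ++ V ++ reverse p) (sym (reverse-map not W)))

  ≈-reverse : x ≈[ A ] y → reverse x ≈[ reverse A ] reverse y
  ≈-reverse = gmap reverse flipStep-reverse

  ≈-reverse⁻ : reverse x ≈[ reverse A ] reverse y → x ≈[ A ] y
  ≈-reverse⁻ {x} {A} {y} h =
    subst (λ B → x ≈[ B ] y) (reverse-involutive A)
      (subst₂ (_≈[ reverse (reverse A) ]_) (reverse-involutive x) (reverse-involutive y) (≈-reverse h))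

  ≈-++ʳ : ∀ w → x ≈[ A ] y → x ++ w ≈[ A ] y ++ w
  ≈-++ʳ {x} {A} {y} w h = ≈-reverse⁻
    (subst₂ _≈[ reverse A ]_ (sym (reverse-++ x w)) (sym (reverse-++ y w))
      (≈-++ˡ (reverse w) (≈-reverse h)))

  data ConsFlip (A : List Bool) (c : Bool) (x : List Bool) : List Bool → Set where
    unchanged : ConsFlip A c x (c ∷ x)
    inside    : ∀ {x′} → FlipStep A x x′ → ConsFlip A c x (c ∷ x′)
    atHead    : ∀ {W z} → (c ∷ W) ∈± A → x ≡ W ++ z → ConsFlip A c x (not c ∷ negL W ++ z)

  consFlip : ∀ {X Y} → FlipStep A X Y → X ≡ c ∷ x → ConsFlip A c x Y
  consFlip (flipAt (_ ∷ p) W q e)  refl = inside (flipAt p W q e)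
  consFlip (flipAt [] []      q e) refl = unchanged
  consFlip (flipAt [] (_ ∷ W) q e) refl = atHead e refl

  FlipsHeadOnce : List Bool → Bool → List Bool → List Bool → Set
  FlipsHeadOnce A c x y = ∃₂ λ W z → (c ∷ W) ∈± A × x ≈[ A ] W ++ z × negL W ++ z ≈[ A ] y

  HeadDecomposition : List Bool → Bool → List Bool → Bool → List Bool → Set
  HeadDecomposition A c x b y = (c ≡ b → x ≈[ A ] y) × (c ≡ not b → FlipsHeadOnce A c x y)

  CancelsBelow : List Bool → ℕ → Set
  CancelsBelow A n = ∀ {c x y} → length x < n → c ∷ x ≈[ A ] c ∷ y → x ≈[ A ] y

  ++-cancelˡ-below : CancelsBelow A n → ∀ p → length (p ++ x) ≤ n →
                     p ++ x ≈[ A ] p ++ y → x ≈[ A ] y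
  ++-cancelˡ-below ih []      _   h = h
  ++-cancelˡ-below ih (_ ∷ p) len h = ++-cancelˡ-below ih p (<⇒≤ len) (ih len h)

  ≈-∷-decompose : ∀ {Y} → CancelsBelow A n → length x ≡ n →
                  c ∷ x ≈[ A ] Y → Y ≡ b ∷ y → HeadDecomposition A c x b y
  ≈-∷-decompose ih len ε refl = (λ _ → ε) , (λ c≡¬c → ⊥-elim (not-¬ refl c≡¬c))
  ≈-∷-decompose {A} {n} {x} {c} {b} {y} ih len (s ◅ rest) eq with consFlip s refl
  ... | unchanged = ≈-∷-decompose ih len rest eq
  ... | inside {x′} s′ = (λ c≡b → s′ ◅ proj₁ IH c≡b) , flipped
    where
    IH : HeadDecomposition A c x′ b y
    IH = ≈-∷-decompose ih (trans (flipStep-length s′) len) rest eq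
    flipped : c ≡ not b → FlipsHeadOnce A c x y
    flipped c≡¬b with W , z , e , before , after ← proj₂ IH c≡¬b =
      W , z , e , s′ ◅ before , after
  ... | atHead {W} {z} e refl =
    kept , (λ c≡¬b → W , z , e , ε , proj₁ IH (trans (cong not c≡¬b) (not-involutive b)))
    where
    |¬Wz| : length (negL W ++ z) ≡ n
    |¬Wz| = trans (length-negL-middle [] W z) len
    IH : HeadDecomposition A (not c) (negL W ++ z) b y
    IH = ≈-∷-decompose ih |¬Wz| rest eq
    kept : c ≡ b → W ++ z ≈[ A ] y
    kept c≡b with proj₂ IH (cong not c≡b)
    ... | W′ , z′ , e′ , before , after with refl ← ∈±-∷-not e e′ =
      ≈-++ˡ W (++-cancelˡ-below ih (negL W) (≤-reflexive |¬Wz|) before)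
        ◅◅ subst (λ V → V ++ z′ ≈[ A ] y) (negL-involutive W) after

  ∷-cancel-below : ∀ n → CancelsBelow A n
  ∷-cancel-below zero    ()
  ∷-cancel-below (suc n) (s≤s |x|≤n) h =
    proj₁ (≈-∷-decompose (λ lt → ∷-cancel-below n (<-≤-trans lt |x|≤n)) refl h refl) refl

  ++-cancelˡ : ∀ w → w ++ x ≈[ A ] w ++ y → x ≈[ A ] y
  ++-cancelˡ {x} w = ++-cancelˡ-below (∷-cancel-below (length (w ++ x))) w ≤-refl

  ++-cancelʳ : ∀ w → x ++ w ≈[ A ] y ++ w → x ≈[ A ] y
  ++-cancelʳ {x} {A} {y} w h = ≈-reverse⁻
    (++-cancelˡ (reverse w) (subst₂ _≈[ reverse A ]_ (reverse-++ x w) (reverse-++ y w) (≈-reverse h)))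

module WordsAsLists where

  open ListRewriting
  open import Data.Bool.Properties using () renaming (_≟_ to _≟B_)
  open import Data.Fin using (toℕ)
  open import Data.List using (List; []; _∷_; _++_; length; take; drop)
  open import Data.List.Properties using (take++drop≡id; length-++)
  open import Data.List.Relation.Unary.All using ([]; _∷_)
  open import Data.Nat using (_≤?_)
  open import Data.Nat.Properties using (+-suc; +-monoʳ-≤; m≤m+n; module ≤-Reasoning)
  open import Data.Vec using ([]; _∷_; lookup; tabulate; toList)
  open import Data.Vec.Properties
    using (≡-dec; tabulate-cong; tabulate∘lookup; toList-map; toList-injective; cast-is-id; length-toList)
  open import Relation.Nullary using (yes; no; contradiction; _⊎-dec_)
  open import Relation.Nullary.Decidable using (isYes≗does)

  private variable
    m N : ℕ

  take-drop-split : ∀ i k (L : List Bool) → take i L ++ take k (drop i L) ++ drop k (drop i L) ≡ L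
  take-drop-split i k L = trans (cong (take i L ++_) (take++drop≡id k (drop i L))) (take++drop≡id i L)

  take-length-++ : ∀ (xs ys : List Bool) → take (length xs) (xs ++ ys) ≡ xs
  take-length-++ []       ys = refl
  take-length-++ (x ∷ xs) ys = cong (x ∷_) (take-length-++ xs ys)

  drop-length-++ : ∀ (xs ys : List Bool) → drop (length xs) (xs ++ ys) ≡ ys
  drop-length-++ []       ys = refl
  drop-length-++ (x ∷ xs) ys = drop-length-++ xs ys

  take-drop-at : ∀ {L : List Bool} {k} p W q → L ≡ p ++ W ++ q → length W ≡ k →
    take (length p) L ≡ p × take k (drop (length p) L) ≡ W × drop k (drop (length p) L) ≡ q
  take-drop-at p W q refl refl rewrite drop-length-++ p (W ++ q) =
    take-length-++ p (W ++ q) , take-length-++ W q , drop-length-++ W q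

  -- Unlike ⌊ i ≤? j ⌋, which carries a proof depending on i and j, the test i ≤ᵇ j is
  -- definitionally invariant under shifting both sides, so flipRange unfolds through this form.
  flipRangeᵇ : (m i : ℕ) → Word N → Word N
  flipRangeᵇ m i u = tabulate λ k →
    if (i ≤ᵇ suc (toℕ k)) ∧ (suc (toℕ k) ≤ᵇ i + m) then not (lookup u k) else lookup u k

  flipRange≡flipRangeᵇ : ∀ m i (u : Word N) → flipRange m i u ≡ flipRangeᵇ m i u
  flipRange≡flipRangeᵇ m i u = tabulate-cong λ k →
    cong (λ b → if b then not (lookup u k) else lookup u k) (isYes≗does _)

  flipRangeᵇ-toList : ∀ m i (u : Word N) → let L = toList u in
    toList (flipRangeᵇ m (suc i) u)
      ≡ take i L ++ negL (take (suc m) (drop i L)) ++ drop (suc m) (drop i L)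
  flipRangeᵇ-toList m       zero    []      = refl
  flipRangeᵇ-toList m       (suc i) []      = refl
  flipRangeᵇ-toList m       (suc i) (x ∷ u) = cong (x ∷_) (flipRangeᵇ-toList m i u)
  flipRangeᵇ-toList zero    zero    (x ∷ u) = cong (not x ∷_) (cong toList (tabulate∘lookup u))
  flipRangeᵇ-toList (suc m) zero    (x ∷ u) = cong (not x ∷_) (flipRangeᵇ-toList m zero u)

  flipRange-toList : ∀ m i (u : Word N) → let L = toList u in
    toList (flipRange m (suc i) u)
      ≡ take i L ++ negL (take (suc m) (drop i L)) ++ drop (suc m) (drop i L)
  flipRange-toList m i u =
    trans (cong toList (flipRange≡flipRangeᵇ m (suc i) u)) (flipRangeᵇ-toList m i u)

  window-toList : ∀ m i (u : Word N) p q →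
                  toList (window m u (suc i) p q) ≡ take (suc m) (drop i (toList u))
  window-toList m       i       []      p ()
  window-toList m       (suc i) (x ∷ u) p q = window-toList m i u (s≤s z≤n) (s≤s⁻¹ q)
  window-toList zero    zero    (x ∷ u) p q = refl
  window-toList (suc m) zero    (x ∷ u) p q = cong (x ∷_) (window-toList m zero u p (s≤s⁻¹ q))

  toList-injective′ : ∀ {v w : Word m} → toList v ≡ toList w → v ≡ w
  toList-injective′ {v = v} {w} eq = trans (sym (cast-is-id refl v)) (toList-injective refl v w eq)

  ∈±-toList⁺ : ∀ {v a : Word m} → v ≡ a ⊎ v ≡ neg a → toList v ∈± toList a
  ∈±-toList⁺ (inj₁ refl) = inj₁ refl
  ∈±-toList⁺ {a = a} (inj₂ refl) = inj₂ (toList-map not a)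

  ∈±-toList⁻ : ∀ {v a : Word m} → toList v ∈± toList a → v ≡ a ⊎ v ≡ neg a
  ∈±-toList⁻ (inj₁ e) = inj₁ (toList-injective′ e)
  ∈±-toList⁻ {a = a} (inj₂ e) = inj₂ (toList-injective′ (trans e (sym (toList-map not a))))

  data Firing (a : Word (suc m)) (u : Word N) : ℕ → Word N → Set where
    idle  : ∀ {i} → Firing a u i u
    fires : ∀ {i} q → toList (window m u (suc i) (s≤s z≤n) q) ∈± toList a →
            Firing a u (suc i) (flipRange m (suc i) u)

  firing : ∀ (a : Word (suc m)) i (u : Word N) → Firing a u i (φ a i u)
  firing a zero u = idle
  firing {m} {N} a (suc i) u with 1 ≤? suc i | suc i + m ≤? N
  ... | yes p | yes q with ≡-dec _≟B_ (window m u (suc i) p q) a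
                          ⊎-dec ≡-dec _≟B_ (window m u (suc i) p q) (neg a)
  ...   | yes e = fires q (∈±-toList⁺ e)
  ...   | no _  = idle
  firing a (suc i) u | yes _ | no _ = idle
  firing a (suc i) u | no _  | _    = idle

  φ-fires : ∀ (a : Word (suc m)) i (u : Word N) q →
            toList (window m u (suc i) (s≤s z≤n) q) ∈± toList a →
            φ a (suc i) u ≡ flipRange m (suc i) u
  φ-fires {m} {N} a i u q′ e with 1 ≤? suc i | suc i + m ≤? N
  ... | yes p | yes q with ≡-dec _≟B_ (window m u (suc i) p q) a
                          ⊎-dec ≡-dec _≟B_ (window m u (suc i) p q) (neg a)
  ...   | yes _ = refl
  ...   | no ¬e = contradiction (∈±-toList⁻ e) ¬e
  φ-fires a i u q′ e | yes _ | no ¬q = contradiction q′ ¬q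
  φ-fires a i u q′ e | no ¬p | _     = contradiction (s≤s z≤n) ¬p

  window-fits : ∀ (u : Word N) p W q → p ++ W ++ q ≡ toList u → length W ≡ suc m →
                suc (length p) + m ≤ N
  window-fits {N} {m} u p W q eq |W| = begin
    suc (length p) + m               ≡⟨ +-suc (length p) m ⟨
    length p + suc m                 ≡⟨ cong (length p +_) |W| ⟨
    length p + length W              ≤⟨ +-monoʳ-≤ (length p) (m≤m+n (length W) (length q)) ⟩
    length p + (length W + length q) ≡⟨ cong (length p +_) (length-++ W) ⟨
    length p + length (W ++ q)       ≡⟨ length-++ p ⟨
    length (p ++ W ++ q)             ≡⟨ cong length eq ⟩
    length (toList u)                ≡⟨ length-toList u ⟩
    N                                ∎
    where open ≤-Reasoning

  φ-≈ : ∀ (a : Word (suc m)) i (u : Word N) → toList u ≈[ toList a ] toList (φ a i u)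
  φ-≈ {m} a i u with φ a i u | firing a i u
  ... | _ | idle         = ε
  ... | _ | fires {i} q e =
    subst₂ (FlipStep (toList a)) (take-drop-split i (suc m) L) (sym (flipRange-toList m i u))
      (flipAt (take i L) (take (suc m) (drop i L)) (drop (suc m) (drop i L))
        (subst (_∈± toList a) (window-toList m i u (s≤s z≤n) q) e))
    ◅ ε
    where
    L : List Bool
    L = toList u

  flipStep-φ : ∀ (a : Word (suc m)) (u : Word N) {X Z} → X ≡ toList u → FlipStep (toList a) X Z →
               ∃ λ i → (1 ≤ i × i ≤ N) × toList (φ a i u) ≡ Z
  flipStep-φ {m} {N} a u eq (flipAt p W q e) =
    suc (length p) , (s≤s z≤n , ≤-trans (m≤m+n (suc (length p)) m) bound) , (begin
      toList (φ a (suc (length p)) u)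
        ≡⟨ cong toList (φ-fires a (length p) u bound (subst (_∈± toList a) (sym window≡W) e)) ⟩
      toList (flipRange m (suc (length p)) u)
        ≡⟨ flipRange-toList m (length p) u ⟩
      take (length p) L ++ negL (take (suc m) (drop (length p) L)) ++ drop (suc m) (drop (length p) L)
        ≡⟨ cong₂ _++_ prefix (cong₂ _++_ (cong negL middle) suffix) ⟩
      p ++ negL W ++ q ∎)
    where
    open ≡-Reasoning
    L : List Bool
    L = toList u
    |W| : length W ≡ suc m
    |W| = trans (∈±-length e) (length-toList a)
    prefix : take (length p) L ≡ p
    prefix = proj₁ (take-drop-at p W q (sym eq) |W|)
    middle : take (suc m) (drop (length p) L) ≡ W
    middle = proj₁ (proj₂ (take-drop-at p W q (sym eq) |W|))
    suffix : drop (suc m) (drop (length p) L) ≡ q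
    suffix = proj₂ (proj₂ (take-drop-at p W q (sym eq) |W|))
    bound : suc (length p) + m ≤ N
    bound = window-fits u p W q eq |W|
    window≡W : toList (window m u (suc (length p)) (s≤s z≤n) bound) ≡ W
    window≡W = trans (window-toList m (length p) u (s≤s z≤n) bound) middle

  applySeq-≈ : ∀ (a : Word (suc m)) is (u : Word N) → toList u ≈[ toList a ] toList (applySeq a is u)
  applySeq-≈ a []       u = ε
  applySeq-≈ a (i ∷ is) u = φ-≈ a i u ◅◅ applySeq-≈ a is (φ a i u)

  ∼⇒≈ : ∀ {a : Word (suc m)} {u v : Word N} → u ∼[ a ] v → toList u ≈[ toList a ] toList v
  ∼⇒≈ {a = a} {u} (is , _ , refl) = applySeq-≈ a is u

  ≈⇒∼ : ∀ {a : Word (suc m)} {u v : Word N} → toList u ≈[ toList a ] toList v → u ∼[ a ] v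
  ≈⇒∼ {a = a} {u} {v} = go u refl
    where
    go : ∀ u {X} → X ≡ toList u → X ≈[ toList a ] toList v → u ∼[ a ] v
    go u eq ε = [] , [] , toList-injective′ (sym eq)
    go u eq (s ◅ rest) =
      let i , bounds , φu≡ = flipStep-φ a u eq s
          is , inRange , applied = go (φ a i u) (sym φu≡) rest
      in i ∷ is , bounds ∷ inRange , applied

open ListRewriting using (_≈[_]_; ≈-++ˡ; ≈-++ʳ; ++-cancelˡ; ++-cancelʳ)
open WordsAsLists using (∼⇒≈; ≈⇒∼)
open import Data.Vec using (_++_; toList)
open import Data.Vec.Properties using (toList-++)
open import Function.Bundles using (_⇔_; mk⇔)

module _ {m n n′ : ℕ} (a : Word (suc m)) (u v : Word n) (w : Word n′) where

  ∼-++ʳ : (u ∼[ a ] v) ⇔ ((u ++ w) ∼[ a ] (v ++ w))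
  ∼-++ʳ = mk⇔
    (λ u∼v → ≈⇒∼ (subst₂ _≈[ toList a ]_ (sym (toList-++ u w)) (sym (toList-++ v w))
                   (≈-++ʳ (toList w) (∼⇒≈ u∼v))))
    (λ uw∼vw → ≈⇒∼ (++-cancelʳ (toList w)
                     (subst₂ _≈[ toList a ]_ (toList-++ u w) (toList-++ v w) (∼⇒≈ uw∼vw))))

  ∼-++ˡ : (u ∼[ a ] v) ⇔ ((w ++ u) ∼[ a ] (w ++ v))
  ∼-++ˡ = mk⇔
    (λ u∼v → ≈⇒∼ (subst₂ _≈[ toList a ]_ (sym (toList-++ w u)) (sym (toList-++ w v))
                   (≈-++ˡ (toList w) (∼⇒≈ u∼v))))
    (λ wu∼wv → ≈⇒∼ (++-cancelˡ (toList w)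
                     (subst₂ _≈[ toList a ]_ (toList-++ w u) (toList-++ w v) (∼⇒≈ wu∼wv))))

lemma2p3 : (m : ℕ) → 1 ≤ m → (a : Word (suc m))
    → (n n′ : ℕ) → 1 ≤ n → 1 ≤ n′
    → (u v : Word n) (w : Word n′)
    → ((u ∼[ a ] v) ⇔ ((u ++ w) ∼[ a ] (v ++ w)))
      × ((u ∼[ a ] v) ⇔ ((w ++ u) ∼[ a ] (w ++ v)))
lemma2p3 m _ a n n′ _ _ u v w = ∼-++ʳ a u v w , ∼-++ˡ a u v w
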